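{- Let $k\ge1$, $\mathsf{ops}\subseteq\{+,-,\times,\div\}$, and let $I=(A,t,D)$ be an instance of a variant of Arithmetic Expression Construction over $\mathbb{Q}(x_1,\ldots,x_k)$ with operations $\mathsf{ops}$, represented in the paired model with $t=(f_t,g_t)$. Let $B\in\mathbb{N}$ be $I$-sufficient. Let $E$ be any expression tree valid for the instance (internal operations in $\mathsf{ops}$, leaves the elements of $A$ subject to the restriction $D$). Then $E$ evaluated on the values $a_i(x_1,\ldots,x_k)$ equals $t(x_1,\ldots,x_k)$ if and only if $E$ evaluated on the values $a_i(x_1,\ldots,x_{k-1},B)$ equals $t(x_1,\ldots,x_{k-1},B)$.
   Context: Expression trees and AEC: an expression tree is a rooted binary tree with values at leaves and operations from $\{+,-,\times,\div\}$ at internal nodes, evaluated in the natural way. In the Standard variant, given a multiset $A$ and target $t$, one asks for an expression tree with operations in $\mathsf{ops}$ using each element of $A$ exactly once as leaves that evaluates to $t$; in the Enforced Leaves variant the left-to-right leaf order is prescribed by $D$; in the Enforced Operations variant the tree with its operations is prescribed by $D$ and only the assignment of elements of $A$ to leaves is free. Paired model: each value is a pair $(f,g)$ with $f,g\in\mathbb{Z}[x_1,\ldots,x_k]$ (standing for $f/g$), with operations $(f,g)+(a,b)=(fb+ga,gb)$, $(f,g)-(a,b)=(fb-ga,gb)$, $(f,g)\times(a,b)=(fa,gb)$, $(f,g)\div(a,b)=(fb,ga)$, and $(f,g)\sim(a,b)$ iff $fb=ga$. Each input value and the target are given as fixed such pairs. $I$-sufficiency: a positive integer $B$ is $I$-sufficient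 if for every valid expression tree $E$ of the instance, its evaluation $(f,g)$ in the paired model is such that all coefficients of $fg_t$ and of $f_tg$ have absolute value less than $B/2$. -}

module Defs where

open import Data.Nat as ℕ using (ℕ; zero; suc)
open import Data.Integer as ℤ using (ℤ; +_; ∣_∣)
open import Data.List using (List; []; _∷_; _++_; foldr)
open import Data.List.Relation.Unary.All using (All)
open import Data.List.Relation.Binary.Permutation.Propositional using (_↭_)
open import Data.List.Membership.Propositional using (_∈_)
open import Data.Product using (_×_; _,_; proj₁; proj₂)
open import Data.Unit using (⊤)
open import Relation.Binary.PropositionalEquality using (_≡_)

-- Poly (suc k) = List (Poly k): the list [c₀, c₁, …] stands for
-- Σ cᵢ · x_{k+1}^i with cᵢ ∈ ℤ[x₁,…,x_k]; so the OUTERMOST list layer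
-- is the LAST variable x_{k+1}.

Poly : ℕ → Set
Poly zero    = ℤ
Poly (suc k) = List (Poly k)

0P : ∀ {k} → Poly k
0P {zero}  = + 0
0P {suc k} = []

constP : ∀ {k} → ℤ → Poly k
constP {zero}  c = c
constP {suc k} c = constP {k} c ∷ []

infixl 6 _+P_
infixl 7 _*P_

_+P_ : ∀ {k} → Poly k → Poly k → Poly k
_+P_ {zero}  a b = a ℤ.+ b
_+P_ {suc k} [] q = q
_+P_ {suc k} (a ∷ p) [] = a ∷ p
_+P_ {suc k} (a ∷ p) (b ∷ q) = (a +P b) ∷ (p +P q)

negP : ∀ {k} → Poly k → Poly k
negP {zero}  a = ℤ.- a
negP {suc k} [] = []
negP {suc k} (a ∷ p) = negP a ∷ negP p

scaleP : ∀ {k} → Poly k → Poly (suc k) → Poly (suc k)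
_*P_ : ∀ {k} → Poly k → Poly k → Poly k

scaleP a [] = []
scaleP a (b ∷ q) = (a *P b) ∷ scaleP a q

_*P_ {zero}  a b = a ℤ.* b
_*P_ {suc k} [] q = []
_*P_ {suc k} (a ∷ p) q = scaleP a q +P (0P ∷ (p *P q))

IsZero : ∀ {k} → Poly k → Set
IsZero {zero}  c = c ≡ + 0
IsZero {suc k} p = All IsZero p

_≈P_ : ∀ {k} → Poly k → Poly k → Set
p ≈P q = IsZero (p +P negP q)

AllCoeffs : ∀ {k} → (ℤ → Set) → Poly k → Set
AllCoeffs {zero}  P c = P c
AllCoeffs {suc k} P p = All (AllCoeffs P) p

CoeffsBelowHalf : ∀ {k} → ℕ → Poly k → Set
CoeffsBelowHalf B = AllCoeffs (λ c → 2 ℕ.* ∣ c ∣ ℕ.< B)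

substLast : ∀ {k} → ℤ → Poly (suc k) → Poly k
substLast b = foldr (λ c acc → c +P (constP b *P acc)) 0P

Pair : ℕ → Set
Pair k = Poly k × Poly k

data Op : Set where
  plus minus times divide : Op

applyOp : ∀ {k} → Op → Pair k → Pair k → Pair k
applyOp plus   (f , g) (a , b) = (f *P b +P g *P a , g *P b)
applyOp minus  (f , g) (a , b) = (f *P b +P negP (g *P a) , g *P b)
applyOp times  (f , g) (a , b) = (f *P a , g *P b)
applyOp divide (f , g) (a , b) = (f *P b , g *P a)

_∼_ : ∀ {k} → Pair k → Pair k → Set
(f , g) ∼ (a , b) = (f *P b) ≈P (g *P a)

substPair : ∀ {k} → ℤ → Pair (suc k) → Pair k
substPair b (f , g) = (substLast b f , substLast b g)

data Tree (L : Set) : Set where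
  leaf : L → Tree L
  node : Op → Tree L → Tree L → Tree L

leaves : ∀ {L} → Tree L → List L
leaves (leaf x) = x ∷ []
leaves (node o l r) = leaves l ++ leaves r

mapLeaves : ∀ {L M} → (L → M) → Tree L → Tree M
mapLeaves h (leaf x) = leaf (h x)
mapLeaves h (node o l r) = node o (mapLeaves h l) (mapLeaves h r)

shape : ∀ {L} → Tree L → Tree ⊤
shape = mapLeaves (λ _ → _)

OpsIn : ∀ {L} → List Op → Tree L → Set
OpsIn ops (leaf x) = ⊤
OpsIn ops (node o l r) = (o ∈ ops) × (OpsIn ops l × OpsIn ops r)

evalTree : ∀ {k} → Tree (Pair k) → Pair k
evalTree (leaf x) = x
evalTree (node o l r) = applyOp o (evalTree l) (evalTree r)

data Variant : Set where
  standard enforcedLeaves enforcedOperations : Variant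

Restriction : Variant → ℕ → Set
Restriction standard           k = ⊤
Restriction enforcedLeaves     k = List (Pair k)
Restriction enforcedOperations k = Tree ⊤

record Instance (k : ℕ) : Set where
  field
    variant : Variant
    A       : List (Pair k)
    t       : Pair k
    D       : Restriction variant k

open Instance public

RespectsD : ∀ {k} (v : Variant) → Restriction v k → Tree (Pair k) → Set
RespectsD standard           d E = ⊤
RespectsD enforcedLeaves     d E = leaves E ≡ d
RespectsD enforcedOperations d E = shape E ≡ d

Valid : ∀ {k} → List Op → Instance k → Tree (Pair k) → Set
Valid ops I E = OpsIn ops E × ((leaves E ↭ A I) × RespectsD (variant I) (D I) E)

Sufficient : ∀ {k} → List Op → Instance k → ℕ → Set
Sufficient {k} ops I B =
  (0 ℕ.< B) ×
  (∀ (E : Tree (Pair k)) → Valid ops I E →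
     CoeffsBelowHalf B (proj₁ (evalTree E) *P proj₂ (t I)) ×
     CoeffsBelowHalf B (proj₁ (t I) *P proj₂ (evalTree E)))

{-# OPTIONS --safe #-}
-- Write E for the value (f, g) of the tree and c = f g_t - g f_t, so that E ∼ t says c = 0
-- and the substituted statement says c(x₁, …, x_{k-1}, B) = 0. The first implies the
-- second by evaluation. Conversely, I-sufficiency gives |coefficient| < B for every
-- coefficient of c (using g f_t = f_t g), so each coefficient of c(…, B) is a base-B
-- expansion, with digits of absolute value < B, whose digits are coefficients of c; it
-- vanishes only if they all do. Identities between polynomials are transported through their
-- values at integer points, a polynomial vanishing at all of them being zero.
module Submission where

open import Defs
open import Data.Nat using (ℕ; suc)
open import Data.Integer using (+_)
open import Data.List using (List)
open import Function.Bundles using (_⇔_)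

open import Data.Nat as ℕ using (zero)
import Data.Nat.Properties as ℕP
open import Data.Integer using (ℤ; _+_; _*_; -_; _-_; ∣_∣)
import Data.Integer.Properties as ℤP
open import Data.Integer.Tactic.RingSolver using (solve-∀)
open import Algebra.Properties.AbelianGroup ℤP.+-0-abelianGroup using (inverseˡ-unique)
open import Data.List using ([]; _∷_)
open import Data.List.Relation.Unary.All using ([]; _∷_)
open import Data.Vec using (Vec; []; _∷_)
open import Data.Product using (_×_; _,_; proj₁; proj₂)
open import Function.Base using (_∘_)
open import Function.Bundles using (mk⇔)
open import Relation.Nullary using (contradiction)
open import Relation.Binary.PropositionalEquality
open ≡-Reasoning

m*n<m⇒n≡0 : ∀ m n → m ℕ.* n ℕ.< m → n ≡ 0
m*n<m⇒n≡0 m zero    _      = refl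
m*n<m⇒n≡0 m (suc n) mn<m = contradiction (ℕP.m≤m*n m (suc n)) (ℕP.<⇒≱ mn<m)

digit-unique : ∀ B a c → ∣ a ∣ ℕ.< B → a + + B * c ≡ + 0 → a ≡ + 0 × c ≡ + 0
digit-unique B a c ∣a∣<B a+Bc≡0 = a≡0 , c≡0
  where
  ∣a∣≡B∣c∣ : ∣ a ∣ ≡ B ℕ.* ∣ c ∣
  ∣a∣≡B∣c∣ = begin
    ∣ a ∣             ≡⟨ cong ∣_∣ (inverseˡ-unique a (+ B * c) a+Bc≡0) ⟩
    ∣ - (+ B * c) ∣   ≡⟨ ℤP.∣-i∣≡∣i∣ (+ B * c) ⟩
    ∣ + B * c ∣       ≡⟨ ℤP.abs-* (+ B) c ⟩
    B ℕ.* ∣ c ∣       ∎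
  c≡0 : c ≡ + 0
  c≡0 = ℤP.∣i∣≡0⇒i≡0 (m*n<m⇒n≡0 B ∣ c ∣ (subst (ℕ._< B) ∣a∣≡B∣c∣ ∣a∣<B))
  a≡0 : a ≡ + 0
  a≡0 = begin
    a                 ≡⟨ sym (ℤP.+-identityʳ a) ⟩
    a + + 0           ≡⟨ cong (λ x → a + x) (sym (ℤP.*-zeroʳ (+ B))) ⟩
    a + + B * + 0     ≡⟨ cong (λ x → a + + B * x) (sym c≡0) ⟩
    a + + B * c       ≡⟨ a+Bc≡0 ⟩
    + 0               ∎

∣i-j∣<-halves : ∀ {B} i j → 2 ℕ.* ∣ i ∣ ℕ.< B → 2 ℕ.* ∣ j ∣ ℕ.< B → ∣ i - j ∣ ℕ.< B
∣i-j∣<-halves {B} i j 2∣i∣<B 2∣j∣<B =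
  ℕP.≤-<-trans (ℤP.∣i-j∣≤∣i∣+∣j∣ i j) (ℕP.*-cancelˡ-< 2 (∣ i ∣ ℕ.+ ∣ j ∣) B 2[∣i∣+∣j∣]<2B)
  where
  2[∣i∣+∣j∣]<2B : 2 ℕ.* (∣ i ∣ ℕ.+ ∣ j ∣) ℕ.< 2 ℕ.* B
  2[∣i∣+∣j∣]<2B = subst₂ ℕ._<_ (sym (ℕP.*-distribˡ-+ 2 ∣ i ∣ ∣ j ∣)) (cong (B ℕ.+_) (sym (ℕP.+-identityʳ B)))
                         (ℕP.+-mono-< 2∣i∣<B 2∣j∣<B)

-- The point lists the value of the last variable first, matching the nesting of Poly.
⟦_⟧ : ∀ {k} → Poly k → Vec ℤ k → ℤ
⟦_⟧ {zero}  c       []      = c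
⟦_⟧ {suc k} []      (x ∷ ρ) = + 0
⟦_⟧ {suc k} (a ∷ p) (x ∷ ρ) = ⟦ a ⟧ ρ + x * ⟦ p ⟧ (x ∷ ρ)

⟦0P⟧ : ∀ {k} (ρ : Vec ℤ k) → ⟦ 0P {k} ⟧ ρ ≡ + 0
⟦0P⟧ []      = refl
⟦0P⟧ (x ∷ ρ) = refl

⟦constP⟧ : ∀ {k} c (ρ : Vec ℤ k) → ⟦ constP {k} c ⟧ ρ ≡ c
⟦constP⟧         c []      = refl
⟦constP⟧ {suc k} c (x ∷ ρ) = begin
  ⟦ constP {k} c ⟧ ρ + x * + 0  ≡⟨ cong₂ (λ u v → u + v) (⟦constP⟧ c ρ) (ℤP.*-zeroʳ x) ⟩
  c + + 0                       ≡⟨ ℤP.+-identityʳ c ⟩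
  c                             ∎

⟦+P⟧ : ∀ {k} (p q : Poly k) ρ → ⟦ p +P q ⟧ ρ ≡ ⟦ p ⟧ ρ + ⟦ q ⟧ ρ
⟦+P⟧ {zero}  p       q       []      = refl
⟦+P⟧ {suc k} []      q       (x ∷ ρ) = sym (ℤP.+-identityˡ _)
⟦+P⟧ {suc k} (a ∷ p) []      (x ∷ ρ) = sym (ℤP.+-identityʳ _)
⟦+P⟧ {suc k} (a ∷ p) (b ∷ q) (x ∷ ρ)
  rewrite ⟦+P⟧ a b ρ | ⟦+P⟧ p q (x ∷ ρ) = interchange (⟦ a ⟧ ρ) (⟦ b ⟧ ρ) x (⟦ p ⟧ (x ∷ ρ)) (⟦ q ⟧ (x ∷ ρ))
  where
  interchange : ∀ a b x p q → (a + b) + x * (p + q) ≡ (a + x * p) + (b + x * q)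
  interchange = solve-∀

⟦negP⟧ : ∀ {k} (p : Poly k) ρ → ⟦ negP p ⟧ ρ ≡ - ⟦ p ⟧ ρ
⟦negP⟧ {zero}  p       []      = refl
⟦negP⟧ {suc k} []      (x ∷ ρ) = refl
⟦negP⟧ {suc k} (a ∷ p) (x ∷ ρ)
  rewrite ⟦negP⟧ a ρ | ⟦negP⟧ p (x ∷ ρ) = neg-horner (⟦ a ⟧ ρ) x (⟦ p ⟧ (x ∷ ρ))
  where
  neg-horner : ∀ a x p → - a + x * - p ≡ - (a + x * p)
  neg-horner = solve-∀

⟦*P⟧ : ∀ {k} (p q : Poly k) ρ → ⟦ p *P q ⟧ ρ ≡ ⟦ p ⟧ ρ * ⟦ q ⟧ ρ
⟦scaleP⟧ : ∀ {k} (a : Poly k) q x ρ → ⟦ scaleP a q ⟧ (x ∷ ρ) ≡ ⟦ a ⟧ ρ * ⟦ q ⟧ (x ∷ ρ)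

⟦*P⟧ {zero}  p       q []      = refl
⟦*P⟧ {suc k} []      q (x ∷ ρ) = sym (ℤP.*-zeroˡ (⟦ q ⟧ (x ∷ ρ)))
⟦*P⟧ {suc k} (a ∷ p) q (x ∷ ρ)
  rewrite ⟦+P⟧ (scaleP a q) (0P ∷ (p *P q)) (x ∷ ρ) | ⟦scaleP⟧ a q x ρ | ⟦0P⟧ ρ | ⟦*P⟧ p q (x ∷ ρ)
  = horner-* (⟦ a ⟧ ρ) (⟦ q ⟧ (x ∷ ρ)) x (⟦ p ⟧ (x ∷ ρ))
  where
  horner-* : ∀ a q x p → a * q + (+ 0 + x * (p * q)) ≡ (a + x * p) * q
  horner-* = solve-∀

⟦scaleP⟧ a []      x ρ = sym (ℤP.*-zeroʳ (⟦ a ⟧ ρ))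
⟦scaleP⟧ a (b ∷ q) x ρ
  rewrite ⟦*P⟧ a b ρ | ⟦scaleP⟧ a q x ρ = horner-scale (⟦ a ⟧ ρ) (⟦ b ⟧ ρ) x (⟦ q ⟧ (x ∷ ρ))
  where
  horner-scale : ∀ a b x q → a * b + x * (a * q) ≡ a * (b + x * q)
  horner-scale = solve-∀

⟦substLast⟧ : ∀ {k} b (p : Poly (suc k)) ρ → ⟦ substLast b p ⟧ ρ ≡ ⟦ p ⟧ (b ∷ ρ)
⟦substLast⟧ b []      ρ = ⟦0P⟧ ρ
⟦substLast⟧ b (c ∷ p) ρ = begin
  ⟦ c +P constP b *P substLast b p ⟧ ρ               ≡⟨ ⟦+P⟧ c _ ρ ⟩
  ⟦ c ⟧ ρ + ⟦ constP b *P substLast b p ⟧ ρ          ≡⟨ cong (λ v → ⟦ c ⟧ ρ + v) (⟦*P⟧ (constP b) _ ρ) ⟩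
  ⟦ c ⟧ ρ + ⟦ constP b ⟧ ρ * ⟦ substLast b p ⟧ ρ     ≡⟨ cong₂ (λ u v → ⟦ c ⟧ ρ + u * v) (⟦constP⟧ b ρ) (⟦substLast⟧ b p ρ) ⟩
  ⟦ c ⟧ ρ + b * ⟦ p ⟧ (b ∷ ρ)                        ∎

IsZero⇒⟦⟧≡0 : ∀ {k} (p : Poly k) → IsZero p → ∀ ρ → ⟦ p ⟧ ρ ≡ + 0
IsZero⇒⟦⟧≡0 {zero}  p       p≡0         []      = p≡0
IsZero⇒⟦⟧≡0 {suc k} []      []          (x ∷ ρ) = refl
IsZero⇒⟦⟧≡0 {suc k} (a ∷ p) (a≈0 ∷ p≈0) (x ∷ ρ)
  rewrite IsZero⇒⟦⟧≡0 a a≈0 ρ | IsZero⇒⟦⟧≡0 p p≈0 (x ∷ ρ) | ℤP.*-zeroʳ x = refl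

-- In the last variable it suffices to vanish at positive integers: at x = 1 + |a|,
-- the constant term a of a + x q(x) is a base-x digit of 0.
⟦⟧≡0⇒IsZero : ∀ {k} (p : Poly k) → (∀ ρ → ⟦ p ⟧ ρ ≡ + 0) → IsZero p
vanishes-on-positives⇒IsZero : ∀ {k} (p : Poly (suc k)) →
  (∀ n ρ → ⟦ p ⟧ (+ suc n ∷ ρ) ≡ + 0) → IsZero p

⟦⟧≡0⇒IsZero {zero}  p vanish = vanish []
⟦⟧≡0⇒IsZero {suc k} p vanish = vanishes-on-positives⇒IsZero p (λ n ρ → vanish (+ suc n ∷ ρ))

vanishes-on-positives⇒IsZero []      vanish = []
vanishes-on-positives⇒IsZero (a ∷ q) vanish =
  ⟦⟧≡0⇒IsZero a a-vanishes ∷ vanishes-on-positives⇒IsZero q q-vanishes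
  where
  a-vanishes : ∀ ρ → ⟦ a ⟧ ρ ≡ + 0
  a-vanishes ρ = proj₁ (digit-unique (suc ∣ ⟦ a ⟧ ρ ∣) (⟦ a ⟧ ρ) _ (ℕP.n<1+n _) (vanish ∣ ⟦ a ⟧ ρ ∣ ρ))
  q-vanishes : ∀ n ρ → ⟦ q ⟧ (+ suc n ∷ ρ) ≡ + 0
  q-vanishes n ρ = proj₂ (digit-unique (suc n) (⟦ a ⟧ ρ) _ ∣a∣<1+n (vanish n ρ))
    where
    ∣a∣<1+n : ∣ ⟦ a ⟧ ρ ∣ ℕ.< suc n
    ∣a∣<1+n rewrite a-vanishes ρ = ℕ.z<s

IsZero-resp-⟦⟧ : ∀ {k} (p q : Poly k) → ⟦ p ⟧ ≗ ⟦ q ⟧ → IsZero p → IsZero q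
IsZero-resp-⟦⟧ p q p≗q p≈0 = ⟦⟧≡0⇒IsZero q (λ ρ → trans (sym (p≗q ρ)) (IsZero⇒⟦⟧≡0 p p≈0 ρ))

⟦⟧-≗⇒≈P : ∀ {k} (p q : Poly k) → ⟦ p ⟧ ≗ ⟦ q ⟧ → p ≈P q
⟦⟧-≗⇒≈P p q p≗q = ⟦⟧≡0⇒IsZero (p +P negP q) λ ρ → begin
  ⟦ p +P negP q ⟧ ρ       ≡⟨ ⟦+P⟧ p (negP q) ρ ⟩
  ⟦ p ⟧ ρ + ⟦ negP q ⟧ ρ  ≡⟨ cong₂ _+_ (p≗q ρ) (⟦negP⟧ q ρ) ⟩
  ⟦ q ⟧ ρ - ⟦ q ⟧ ρ       ≡⟨ ℤP.+-inverseʳ (⟦ q ⟧ ρ) ⟩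
  + 0                     ∎

*P-comm : ∀ {k} (p q : Poly k) → (p *P q) ≈P (q *P p)
*P-comm p q = ⟦⟧-≗⇒≈P (p *P q) (q *P p) λ ρ → begin
  ⟦ p *P q ⟧ ρ        ≡⟨ ⟦*P⟧ p q ρ ⟩
  ⟦ p ⟧ ρ * ⟦ q ⟧ ρ   ≡⟨ ℤP.*-comm (⟦ p ⟧ ρ) (⟦ q ⟧ ρ) ⟩
  ⟦ q ⟧ ρ * ⟦ p ⟧ ρ   ≡⟨ ⟦*P⟧ q p ρ ⟨
  ⟦ q *P p ⟧ ρ        ∎

IsZero-substLast : ∀ {k} b (p : Poly (suc k)) → IsZero p → IsZero (substLast b p)
IsZero-substLast b p p≈0 =
  ⟦⟧≡0⇒IsZero (substLast b p) (λ ρ → trans (⟦substLast⟧ b p ρ) (IsZero⇒⟦⟧≡0 p p≈0 (b ∷ ρ)))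

-- The exponent of the last variable comes first; exponents past the end of a
-- coefficient list read 0.
coeff : ∀ {k} → Poly k → Vec ℕ k → ℤ
coeff {zero}  c       []          = c
coeff {suc k} []      (i ∷ e)     = + 0
coeff {suc k} (a ∷ p) (zero ∷ e)  = coeff a e
coeff {suc k} (a ∷ p) (suc i ∷ e) = coeff p (i ∷ e)

coeff-0P : ∀ {k} (e : Vec ℕ k) → coeff (0P {k}) e ≡ + 0
coeff-0P []      = refl
coeff-0P (i ∷ e) = refl

coeff-+P : ∀ {k} (p q : Poly k) e → coeff (p +P q) e ≡ coeff p e + coeff q e
coeff-+P {zero}  p       q       []          = refl
coeff-+P {suc k} []      q       (i ∷ e)     = sym (ℤP.+-identityˡ (coeff q (i ∷ e)))
coeff-+P {suc k} (a ∷ p) []      (i ∷ e)     = sym (ℤP.+-identityʳ (coeff (a ∷ p) (i ∷ e)))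
coeff-+P {suc k} (a ∷ p) (b ∷ q) (zero ∷ e)  = coeff-+P a b e
coeff-+P {suc k} (a ∷ p) (b ∷ q) (suc i ∷ e) = coeff-+P p q (i ∷ e)

coeff-negP : ∀ {k} (p : Poly k) e → coeff (negP p) e ≡ - coeff p e
coeff-negP {zero}  p       []          = refl
coeff-negP {suc k} []      (i ∷ e)     = refl
coeff-negP {suc k} (a ∷ p) (zero ∷ e)  = coeff-negP a e
coeff-negP {suc k} (a ∷ p) (suc i ∷ e) = coeff-negP p (i ∷ e)

coeff-constP-*P : ∀ {k} c (r : Poly k) e → coeff (constP c *P r) e ≡ c * coeff r e
coeff-scaleP-constP : ∀ {k} c (r : Poly (suc k)) i e →
  coeff (scaleP (constP c) r) (i ∷ e) ≡ c * coeff r (i ∷ e)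

coeff-constP-*P {zero}  c r []      = refl
coeff-constP-*P {suc k} c r (i ∷ e) = begin
  coeff (scaleP (constP c) r +P (0P ∷ [])) (i ∷ e)
    ≡⟨ coeff-+P (scaleP (constP c) r) (0P ∷ []) (i ∷ e) ⟩
  coeff (scaleP (constP c) r) (i ∷ e) + coeff (0P {k} ∷ []) (i ∷ e)
    ≡⟨ cong₂ _+_ (coeff-scaleP-constP c r i e) (coeff-[0P] i) ⟩
  c * coeff r (i ∷ e) + + 0
    ≡⟨ ℤP.+-identityʳ _ ⟩
  c * coeff r (i ∷ e) ∎
  where
  coeff-[0P] : ∀ i → coeff (0P {k} ∷ []) (i ∷ e) ≡ + 0
  coeff-[0P] zero    = coeff-0P e
  coeff-[0P] (suc i) = refl

coeff-scaleP-constP c []      i       e = sym (ℤP.*-zeroʳ c)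
coeff-scaleP-constP c (b ∷ r) zero    e = coeff-constP-*P c b e
coeff-scaleP-constP c (b ∷ r) (suc i) e = coeff-scaleP-constP c r i e

coeff-IsZero : ∀ {k} (p : Poly k) → IsZero p → ∀ e → coeff p e ≡ + 0
coeff-IsZero {zero}  p       p≡0         []          = p≡0
coeff-IsZero {suc k} []      []          (i ∷ e)     = refl
coeff-IsZero {suc k} (a ∷ p) (a≈0 ∷ p≈0) (zero ∷ e)  = coeff-IsZero a a≈0 e
coeff-IsZero {suc k} (a ∷ p) (a≈0 ∷ p≈0) (suc i ∷ e) = coeff-IsZero p p≈0 (i ∷ e)

IsZero-coeff : ∀ {k} (p : Poly k) → (∀ e → coeff p e ≡ + 0) → IsZero p
IsZero-coeff {zero}  p       p≡0 = p≡0 []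
IsZero-coeff {suc k} []      _   = []
IsZero-coeff {suc k} (a ∷ p) p≡0 =
  IsZero-coeff a (λ e → p≡0 (zero ∷ e)) ∷ IsZero-coeff p (λ { (i ∷ e) → p≡0 (suc i ∷ e) })

coeff-≈P : ∀ {k} (p q : Poly k) → p ≈P q → ∀ e → coeff p e ≡ coeff q e
coeff-≈P p q p≈q e = ℤP.i-j≡0⇒i≡j (coeff p e) (coeff q e) (begin
  coeff p e - coeff q e          ≡⟨ cong (λ v → coeff p e + v) (coeff-negP q e) ⟨
  coeff p e + coeff (negP q) e   ≡⟨ coeff-+P p (negP q) e ⟨
  coeff (p +P negP q) e          ≡⟨ coeff-IsZero (p +P negP q) p≈q e ⟩
  + 0                            ∎)

coeff-AllCoeffs : ∀ {k} {P : ℤ → Set} (p : Poly k) → P (+ 0) → AllCoeffs P p → ∀ e → P (coeff p e)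
coeff-AllCoeffs {zero}  p       P0 Pp          []          = Pp
coeff-AllCoeffs {suc k} []      P0 []          (i ∷ e)     = P0
coeff-AllCoeffs {suc k} (a ∷ p) P0 (Pa ∷ Pp)   (zero ∷ e)  = coeff-AllCoeffs a P0 Pa e
coeff-AllCoeffs {suc k} (a ∷ p) P0 (Pa ∷ Pp)   (suc i ∷ e) = coeff-AllCoeffs p P0 Pp (i ∷ e)

-- Writing p = Σ cᵢ xⁱ, each coefficient of p(B) = c₀ + B · (Σ cᵢ₊₁ Bⁱ) has the
-- corresponding coefficient of c₀ as its last base-B digit.
substLast-IsZero⇒IsZero : ∀ {k} B (p : Poly (suc k)) → (∀ e → ∣ coeff p e ∣ ℕ.< B) →
  IsZero (substLast (+ B) p) → IsZero p
substLast-IsZero⇒IsZero B []      small _    = []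
substLast-IsZero⇒IsZero B (c ∷ p) small pB≈0 =
  IsZero-coeff c (proj₁ ∘ digits) ∷
  substLast-IsZero⇒IsZero B p (λ { (i ∷ e) → small (suc i ∷ e) })
    (IsZero-coeff (substLast (+ B) p) (proj₂ ∘ digits))
  where
  digits : ∀ e → coeff c e ≡ + 0 × coeff (substLast (+ B) p) e ≡ + 0
  digits e = digit-unique B (coeff c e) (coeff (substLast (+ B) p) e) (small (zero ∷ e)) (begin
    coeff c e + + B * coeff (substLast (+ B) p) e
      ≡⟨ cong (λ v → coeff c e + v) (coeff-constP-*P (+ B) (substLast (+ B) p) e) ⟨
    coeff c e + coeff (constP (+ B) *P substLast (+ B) p) e
      ≡⟨ coeff-+P c (constP (+ B) *P substLast (+ B) p) e ⟨
    coeff (substLast (+ B) (c ∷ p)) e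
      ≡⟨ coeff-IsZero (substLast (+ B) (c ∷ p)) pB≈0 e ⟩
    + 0 ∎)

-- P ∼ Q is by definition IsZero (cross P Q).
cross : ∀ {k} → Pair k → Pair k → Poly k
cross (f , g) (a , b) = f *P b +P negP (g *P a)

⟦_⟧₂ : ∀ {k} → Pair k → Vec ℤ k → Pair 0
⟦ f , g ⟧₂ ρ = ⟦ f ⟧ ρ , ⟦ g ⟧ ρ

⟦applyOp⟧ : ∀ {k} o (P Q : Pair k) ρ → ⟦ applyOp o P Q ⟧₂ ρ ≡ applyOp o (⟦ P ⟧₂ ρ) (⟦ Q ⟧₂ ρ)
⟦applyOp⟧ plus (f , g) (a , b) ρ =
  cong₂ _,_ (trans (⟦+P⟧ (f *P b) (g *P a) ρ) (cong₂ _+_ (⟦*P⟧ f b ρ) (⟦*P⟧ g a ρ)))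
            (⟦*P⟧ g b ρ)
⟦applyOp⟧ minus (f , g) (a , b) ρ =
  cong₂ _,_ (trans (⟦+P⟧ (f *P b) (negP (g *P a)) ρ)
                   (cong₂ _+_ (⟦*P⟧ f b ρ) (trans (⟦negP⟧ (g *P a) ρ) (cong -_ (⟦*P⟧ g a ρ)))))
            (⟦*P⟧ g b ρ)
⟦applyOp⟧ times  (f , g) (a , b) ρ = cong₂ _,_ (⟦*P⟧ f a ρ) (⟦*P⟧ g b ρ)
⟦applyOp⟧ divide (f , g) (a , b) ρ = cong₂ _,_ (⟦*P⟧ f b ρ) (⟦*P⟧ g a ρ)

-- cross P Q is the numerator of P - Q.
⟦cross⟧ : ∀ {k} (P Q : Pair k) ρ → ⟦ cross P Q ⟧ ρ ≡ cross (⟦ P ⟧₂ ρ) (⟦ Q ⟧₂ ρ)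
⟦cross⟧ P Q ρ = cong proj₁ (⟦applyOp⟧ minus P Q ρ)

⟦substPair⟧ : ∀ {k} b (P : Pair (suc k)) ρ → ⟦ substPair b P ⟧₂ ρ ≡ ⟦ P ⟧₂ (b ∷ ρ)
⟦substPair⟧ b (f , g) ρ = cong₂ _,_ (⟦substLast⟧ b f ρ) (⟦substLast⟧ b g ρ)

⟦evalTree-substPair⟧ : ∀ {k} b (E : Tree (Pair (suc k))) ρ →
  ⟦ evalTree (mapLeaves (substPair b) E) ⟧₂ ρ ≡ ⟦ evalTree E ⟧₂ (b ∷ ρ)
⟦evalTree-substPair⟧ b (leaf P)     ρ = ⟦substPair⟧ b P ρ
⟦evalTree-substPair⟧ {k} b (node o l r) ρ = begin
  ⟦ applyOp o (evalTree l′) (evalTree r′) ⟧₂ ρ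
    ≡⟨ ⟦applyOp⟧ o (evalTree l′) (evalTree r′) ρ ⟩
  applyOp o (⟦ evalTree l′ ⟧₂ ρ) (⟦ evalTree r′ ⟧₂ ρ)
    ≡⟨ cong₂ (applyOp o) (⟦evalTree-substPair⟧ b l ρ) (⟦evalTree-substPair⟧ b r ρ) ⟩
  applyOp o (⟦ evalTree l ⟧₂ (b ∷ ρ)) (⟦ evalTree r ⟧₂ (b ∷ ρ))
    ≡⟨ ⟦applyOp⟧ o (evalTree l) (evalTree r) (b ∷ ρ) ⟨
  ⟦ applyOp o (evalTree l) (evalTree r) ⟧₂ (b ∷ ρ) ∎
  where
  l′ r′ : Tree (Pair k)
  l′ = mapLeaves (substPair b) l
  r′ = mapLeaves (substPair b) r

⟦cross-substPair⟧ : ∀ {k} b (E : Tree (Pair (suc k))) T →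
  ⟦ cross (evalTree (mapLeaves (substPair b) E)) (substPair b T) ⟧ ≗ ⟦ substLast b (cross (evalTree E) T) ⟧
⟦cross-substPair⟧ b E T ρ = begin
  ⟦ cross (evalTree (mapLeaves (substPair b) E)) (substPair b T) ⟧ ρ
    ≡⟨ ⟦cross⟧ (evalTree (mapLeaves (substPair b) E)) (substPair b T) ρ ⟩
  cross (⟦ evalTree (mapLeaves (substPair b) E) ⟧₂ ρ) (⟦ substPair b T ⟧₂ ρ)
    ≡⟨ cong₂ cross (⟦evalTree-substPair⟧ b E ρ) (⟦substPair⟧ b T ρ) ⟩
  cross (⟦ evalTree E ⟧₂ (b ∷ ρ)) (⟦ T ⟧₂ (b ∷ ρ))
    ≡⟨ ⟦cross⟧ (evalTree E) T (b ∷ ρ) ⟨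
  ⟦ cross (evalTree E) T ⟧ (b ∷ ρ)
    ≡⟨ ⟦substLast⟧ b (cross (evalTree E) T) ρ ⟨
  ⟦ substLast b (cross (evalTree E) T) ⟧ ρ ∎

∣coeff-cross∣< : ∀ {k B} (P T : Pair k) → 0 ℕ.< B →
  CoeffsBelowHalf B (proj₁ P *P proj₂ T) → CoeffsBelowHalf B (proj₁ T *P proj₂ P) →
  ∀ e → ∣ coeff (cross P T) e ∣ ℕ.< B
∣coeff-cross∣< {B = B} (f , g) (a , b) 0<B fb-small ag-small e =
  subst (λ c → ∣ c ∣ ℕ.< B) (sym coeff-cross)
    (∣i-j∣<-halves (coeff (f *P b) e) (coeff (a *P g) e)
      (coeff-AllCoeffs (f *P b) 0<B fb-small e) (coeff-AllCoeffs (a *P g) 0<B ag-small e))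
  where
  coeff-cross : coeff (cross (f , g) (a , b)) e ≡ coeff (f *P b) e - coeff (a *P g) e
  coeff-cross = begin
    coeff (f *P b +P negP (g *P a)) e       ≡⟨ coeff-+P (f *P b) (negP (g *P a)) e ⟩
    coeff (f *P b) e + coeff (negP (g *P a)) e
      ≡⟨ cong (λ v → coeff (f *P b) e + v) (coeff-negP (g *P a) e) ⟩
    coeff (f *P b) e - coeff (g *P a) e
      ≡⟨ cong (λ v → coeff (f *P b) e - v) (coeff-≈P (g *P a) (a *P g) (*P-comm g a) e) ⟩
    coeff (f *P b) e - coeff (a *P g) e     ∎

lemma3 : (m : ℕ) (ops : List Op) (I : Instance (suc m)) (B : ℕ) →
    Sufficient ops I B →
    (E : Tree (Pair (suc m))) → Valid ops I E →
    (evalTree E ∼ t I) ⇔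
      (evalTree (mapLeaves (substPair (+ B)) E) ∼ substPair (+ B) (t I))
lemma3 m ops I B (0<B , sufficient) E valid = mk⇔
  (λ P∼T → IsZero-resp-⟦⟧ _ _ (sym ∘ cross-at-B) (IsZero-substLast (+ B) (cross P T) P∼T))
  (λ P′∼T′ → substLast-IsZero⇒IsZero B (cross P T) small (IsZero-resp-⟦⟧ _ _ cross-at-B P′∼T′))
  where
  P T : Pair (suc m)
  P = evalTree E
  T = t I
  cross-at-B : ⟦ cross (evalTree (mapLeaves (substPair (+ B)) E)) (substPair (+ B) T) ⟧ ≗ ⟦ substLast (+ B) (cross P T) ⟧
  cross-at-B = ⟦cross-substPair⟧ (+ B) E T
  small : ∀ e → ∣ coeff (cross P T) e ∣ ℕ.< B
  small = ∣coeff-cross∣< P T 0<B (proj₁ (sufficient E valid)) (proj₂ (sufficient E valid))
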